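{- Let $q$ be a prime power and let $k\ge 1$ and $r\ge k-1$ be integers. Then $m(k,q;q^r)=q^{r-k+1}\cdot\frac{q^k-1}{q-1}$.
   Context: A linear $[n,k]_q$-code is a $k$-dimensional subspace of $\mathbb{F}_q^n$. The support of $c\in\mathbb{F}_q^n$ is $\operatorname{supp}(c)=\{i: c_i\neq 0\}$. A non-zero codeword $c$ of a linear code $C$ is minimal if no non-zero codeword $u\in C$ has $\operatorname{supp}(u)\subsetneq\operatorname{supp}(c)$; $C$ is a minimal code if all its non-zero codewords are minimal. A linear code is $\Delta$-divisible if the Hamming weights of all its codewords are divisible by $\Delta$. For positive integers $k,\Delta$, $m(k,q;\Delta)$ denotes the minimum length $n$ of a $\Delta$-divisible minimal $[n,k]_q$-code. -}

module Defs where

open import Data.Nat using (ℕ; zero; suc; _+_; _*_; _∸_; _^_; _≤_)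
open import Data.Nat.Divisibility using (_∣_)
open import Data.Nat.Primality using (Prime)
open import Data.Fin using (Fin)
open import Data.Product using (Σ; ∃; _×_)
open import Data.Empty using (⊥)
open import Relation.Nullary using (¬_; yes; no)
open import Relation.Binary.Definitions using (DecidableEquality)
open import Relation.Binary.PropositionalEquality using (_≡_)
open import Algebra.Structures using (IsCommutativeRing)
open import Function.Bundles using (_↔_)

IsPrimePower : ℕ → Set
IsPrimePower q = Σ ℕ λ p → Σ ℕ λ e → Prime p × (1 ≤ e) × (q ≡ p ^ e)

record FiniteField (q : ℕ) : Set₁ where
  field
    Carrier : Set
    _+F_ : Carrier → Carrier → Carrier
    _*F_ : Carrier → Carrier → Carrier
    -F_  : Carrier → Carrier
    0F   : Carrier
    1F   : Carrier
    isCommutativeRing : IsCommutativeRing _≡_ _+F_ _*F_ -F_ 0F 1F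
    0≢1  : ¬ (0F ≡ 1F)
    inverse : ∀ x → ¬ (x ≡ 0F) → ∃ λ y → x *F y ≡ 1F
    _≟F_ : DecidableEquality Carrier
    enumeration : Carrier ↔ Fin q

module Codes {q : ℕ} (F : FiniteField q) where
  open FiniteField F

  ΣF : (m : ℕ) → (Fin m → Carrier) → Carrier
  ΣF zero    f = 0F
  ΣF (suc m) f = f Fin.zero +F ΣF m (λ j → f (Fin.suc j))
    where import Data.Fin as Fin

  Σℕ : (m : ℕ) → (Fin m → ℕ) → ℕ
  Σℕ zero    f = 0
  Σℕ (suc m) f = f Fin.zero + Σℕ m (λ j → f (Fin.suc j))
    where import Data.Fin as Fin

  Word : ℕ → Set
  Word n = Fin n → Carrier

  comb : ∀ {k n} → (Fin k → Carrier) → (Fin k → Word n) → Word n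
  comb {k} a G i = ΣF k (λ j → a j *F G j i)

  LinIndep : ∀ {k n} → (Fin k → Word n) → Set
  LinIndep {k} {n} G = ∀ (a : Fin k → Carrier) → (∀ i → comb a G i ≡ 0F) → ∀ j → a j ≡ 0F

  record LinearCode (n k : ℕ) : Set where
    field
      basis : Fin k → Word n
      indep : LinIndep basis

  _∈C_ : ∀ {n k} → Word n → LinearCode n k → Set
  c ∈C C = ∃ λ a → ∀ i → c i ≡ comb a (LinearCode.basis C) i

  NonZeroWord : ∀ {n} → Word n → Set
  NonZeroWord c = ¬ (∀ i → c i ≡ 0F)

  InSupp : ∀ {n} → Word n → Fin n → Set
  InSupp c i = ¬ (c i ≡ 0F)

  _⊆supp_ : ∀ {n} → Word n → Word n → Set
  u ⊆supp c = ∀ i → InSupp u i → InSupp c i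

  _⊊supp_ : ∀ {n} → Word n → Word n → Set
  u ⊊supp c = (u ⊆supp c) × ¬ (c ⊆supp u)

  weight : ∀ {n} → Word n → ℕ
  weight {n} c = Σℕ n (λ i → indicator (c i ≟F 0F))
    where
      open import Relation.Nullary using (Dec)
      indicator : ∀ {P : Set} → Dec P → ℕ
      indicator (yes _) = 0
      indicator (no _)  = 1

  MinimalCodeword : ∀ {n k} → LinearCode n k → Word n → Set
  MinimalCodeword C c = NonZeroWord c ×
    ¬ (∃ λ u → u ∈C C × NonZeroWord u × (u ⊊supp c))

  IsMinimalCode : ∀ {n k} → LinearCode n k → Set
  IsMinimalCode C = ∀ c → c ∈C C → NonZeroWord c → MinimalCodeword C c

  IsDivisible : ∀ {n k} → ℕ → LinearCode n k → Set
  IsDivisible Δ C = ∀ c → c ∈C C → Δ ∣ weight c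

  Admissible : ℕ → ℕ → ℕ → Set
  Admissible k Δ n = Σ (LinearCode n k) λ C → IsDivisible Δ C × IsMinimalCode C

  -- m(k,q;Δ) = N : N is the minimum length of a Δ-divisible minimal [N,k]_q code
  IsMinLength : ℕ → ℕ → ℕ → Set
  IsMinLength k Δ N = Admissible k Δ N × (∀ n → Admissible k Δ n → N ≤ n)

module Submission where

-- Upper bound: repeat each point of PG(k−1,q), i.e. each normalised nonzero vector of F^k, q^(r−k+1)
-- times as a column. Every nonzero codeword then has weight q^(r−k+1)·q^(k−1) = q^r, and a code of
-- constant weight is divisible by that weight and minimal, because a proper inclusion of supports
-- strictly decreases the weight.
-- Lower bound, which uses divisibility only: let c be a codeword of minimal support, so q^s ≤ wt c.
-- On the zero set Z of c, the generators other than one occurring in c remain independent (by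
-- minimality of supp c), and they are q^(s−1)-divisible there, because averaging over the line
-- b + λc gives Σ_λ wt(b + λc) + wt c = q·wt_Z(b) + q·wt c. Induction on the dimension gives
-- n ≥ q^s + q^(s−k+1)·[k−1]_q = q^(s−k+1)·[k]_q.

open import Defs
open import Data.Nat using (ℕ; _*_; _∸_; _^_; _≤_)
open import Data.Product using (Σ; _×_)
open import Relation.Binary.PropositionalEquality using (_≡_)

open import Algebra.Bundles using (CommutativeRing)
import Algebra.Properties.CommutativeSemigroup as CommutativeSemigroupProperties
import Algebra.Properties.Semiring.Sum as SemiringSum
open import Algebra.Structures using (IsCommutativeRing)
open import Data.Bool using (Bool; true; false; if_then_else_; _∧_)
import Data.Bool as Bool
open import Data.Empty using (⊥-elim)
open import Data.List using (List; []; _∷_; _++_; length; map; concat; concatMap; replicate; tabulate; lookup)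
open import Data.Fin using (Fin; zero; suc; punchIn)
import Data.Fin.Properties as Finₚ
open import Data.Nat using (zero; suc; _+_; _<_; z≤n; s≤s; NonZero; >-nonZero; ≢-nonZero⁻¹)
import Data.Nat.Properties as ℕₚ
open import Data.Nat.Induction using (<-wellFounded)
open import Induction.WellFounded using (Acc; acc)
open import Data.Nat.Divisibility using (_∣_)
import Data.Nat.Divisibility as ∣ₚ
open import Data.Product using (∃; _,_; proj₁; proj₂)
open import Data.Vec.Functional using (Vector; head; tail; insertAt; removeAt)
  renaming ([] to []ᵛ; _∷_ to _∷ᵛ_)
open import Data.Vec.Functional.Properties using (insertAt-lookup; insertAt-punchIn)
open import Function.Base using (_∘_)
open import Function.Bundles using (Inverse)
open import Relation.Binary.PropositionalEquality
  using (_≗_; refl; sym; trans; cong; cong₂; subst; subst₂; module ≡-Reasoning)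
open import Relation.Nullary using (¬_; Dec; yes; no; does; ¬?)
open import Relation.Nullary.Decidable using (_×-dec_; _→-dec_; map′)

open ≡-Reasoning

open SemiringSum ℕₚ.+-*-semiring
  using (sum; sum-cong-≗; ∑-distrib-+; ∑-comm; *-distribˡ-sum; sum-replicate-zero)

open CommutativeSemigroupProperties ℕₚ.+-commutativeSemigroup using () renaming (interchange to +-interchange)

sum-const : ∀ n c → sum {n} (λ _ → c) ≡ n * c
sum-const zero    c = refl
sum-const (suc n) c = cong (c +_) (sum-const n c)

sum-mono-≤ : ∀ {n} {f g : Vector ℕ n} → (∀ i → f i ≤ g i) → sum f ≤ sum g
sum-mono-≤ {zero}  f≤g = z≤n
sum-mono-≤ {suc n} f≤g = ℕₚ.+-mono-≤ (f≤g zero) (sum-mono-≤ (f≤g ∘ suc))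

sum-mono-< : ∀ {n} {f g : Vector ℕ n} → (∀ i → f i ≤ g i) → ∀ j → f j < g j → sum f < sum g
sum-mono-< {suc n} f≤g zero    fj<gj = ℕₚ.+-mono-<-≤ fj<gj (sum-mono-≤ (f≤g ∘ suc))
sum-mono-< {suc n} f≤g (suc j) fj<gj = ℕₚ.+-mono-≤-< (f≤g zero) (sum-mono-< (f≤g ∘ suc) j fj<gj)

≤-sum : ∀ {n} (f : Vector ℕ n) j → f j ≤ sum f
≤-sum {suc n} f zero    = ℕₚ.m≤m+n (f zero) _
≤-sum {suc n} f (suc j) = ℕₚ.≤-trans (≤-sum (f ∘ suc) j) (ℕₚ.m≤n+m _ (f zero))

∣-sum : ∀ {d n} (f : Vector ℕ n) → (∀ i → d ∣ f i) → d ∣ sum f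
∣-sum {d} {zero}  f d∣f = d ∣ₚ.∣0
∣-sum {d} {suc n} f d∣f = ∣ₚ.∣m∣n⇒∣m+n (d∣f zero) (∣-sum (f ∘ suc) (d∣f ∘ suc))

^-∸-* : ∀ x {s k} → k ≤ s → x ^ (s ∸ k) * x ^ k ≡ x ^ s
^-∸-* x {s} {k} k≤s = trans (sym (ℕₚ.^-distribˡ-+-* x (s ∸ k) k)) (cong (x ^_) (ℕₚ.m∸n+n≡m k≤s))

𝟙[_≡_] : ∀ {n} → Fin n → Fin n → ℕ
𝟙[ i ≡ j ] = if does (i Finₚ.≟ j) then 1 else 0

sum-𝟙≡ : ∀ {n} (j : Fin n) → sum (λ i → 𝟙[ i ≡ j ]) ≡ 1
sum-𝟙≡ {suc n} zero    = cong suc (sum-replicate-zero n)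
sum-𝟙≡ {suc n} (suc j) = sum-𝟙≡ j

module _ {A : Set} where

  sumₗ : (A → ℕ) → List A → ℕ
  sumₗ f []       = 0
  sumₗ f (x ∷ xs) = f x + sumₗ f xs

  sumₗ-cong : ∀ {f g} → f ≗ g → ∀ xs → sumₗ f xs ≡ sumₗ g xs
  sumₗ-cong f≗g []       = refl
  sumₗ-cong f≗g (x ∷ xs) = cong₂ _+_ (f≗g x) (sumₗ-cong f≗g xs)

  sumₗ-++ : ∀ f xs ys → sumₗ f (xs ++ ys) ≡ sumₗ f xs + sumₗ f ys
  sumₗ-++ f []       ys = refl
  sumₗ-++ f (x ∷ xs) ys = trans (cong (f x +_) (sumₗ-++ f xs ys)) (sym (ℕₚ.+-assoc (f x) _ _))

  sumₗ-+ : ∀ f g xs → sumₗ (λ x → f x + g x) xs ≡ sumₗ f xs + sumₗ g xs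
  sumₗ-+ f g []       = refl
  sumₗ-+ f g (x ∷ xs) = trans (cong (f x + g x +_) (sumₗ-+ f g xs)) (+-interchange (f x) (g x) _ _)

  sumₗ-const : ∀ c xs → sumₗ (λ _ → c) xs ≡ length xs * c
  sumₗ-const c []       = refl
  sumₗ-const c (x ∷ xs) = cong (c +_) (sumₗ-const c xs)

  length≡sumₗ-1 : ∀ xs → length xs ≡ sumₗ (λ _ → 1) xs
  length≡sumₗ-1 xs = sym (trans (sumₗ-const 1 xs) (ℕₚ.*-identityʳ (length xs)))

  sum-lookup : ∀ f xs → sum (f ∘ lookup xs) ≡ sumₗ f xs
  sum-lookup f []       = refl
  sum-lookup f (x ∷ xs) = cong (f x +_) (sum-lookup f xs)

  sumₗ-tabulate : ∀ {m} f (g : Fin m → A) → sumₗ f (tabulate g) ≡ sum (f ∘ g)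
  sumₗ-tabulate {zero}  f g = refl
  sumₗ-tabulate {suc m} f g = cong (f (g zero) +_) (sumₗ-tabulate f (g ∘ suc))

  sumₗ-concat-replicate : ∀ f t xs → sumₗ f (concat (replicate t xs)) ≡ t * sumₗ f xs
  sumₗ-concat-replicate f zero    xs = refl
  sumₗ-concat-replicate f (suc t) xs =
    trans (sumₗ-++ f xs _) (cong (sumₗ f xs +_) (sumₗ-concat-replicate f t xs))

module _ {A B : Set} where

  sumₗ-map : ∀ f (g : A → B) xs → sumₗ f (map g xs) ≡ sumₗ (f ∘ g) xs
  sumₗ-map f g []       = refl
  sumₗ-map f g (x ∷ xs) = cong (f (g x) +_) (sumₗ-map f g xs)

  sumₗ-concatMap : ∀ f (h : A → List B) xs → sumₗ f (concatMap h xs) ≡ sumₗ (sumₗ f ∘ h) xs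
  sumₗ-concatMap f h []       = refl
  sumₗ-concatMap f h (x ∷ xs) = trans (sumₗ-++ f (h x) _) (cong (sumₗ f (h x) +_) (sumₗ-concatMap f h xs))

module CodesOver {q : ℕ} (F : FiniteField q) where
  open FiniteField F
  open Codes F
  open IsCommutativeRing isCommutativeRing
    using ( +-identityˡ; +-identityʳ; +-assoc; +-comm; -‿inverseʳ
          ; *-identityˡ; *-identityʳ; *-assoc; *-comm; distribʳ; zeroˡ; zeroʳ )
  open Inverse enumeration using (to; from; strictlyInverseˡ; strictlyInverseʳ)

  fieldRing : CommutativeRing _ _
  fieldRing = record
    { Carrier = Carrier ; _≈_ = _≡_ ; _+_ = _+F_ ; _*_ = _*F_ ; -_ = -F_
    ; 0# = 0F ; 1# = 1F ; isCommutativeRing = isCommutativeRing }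

  open CommutativeRing fieldRing using (ring; +-group; semiring)
  open import Algebra.Properties.Ring ring using (-‿distribˡ-*)
  open import Algebra.Properties.Group +-group using (inverseʳ-unique)
  module FΣ = SemiringSum semiring

  nonzero*≡0⇒≡0 : ∀ {a y} → ¬ a ≡ 0F → a *F y ≡ 0F → y ≡ 0F
  nonzero*≡0⇒≡0 {a} {y} a≢0 ay≡0 = begin
    y              ≡⟨ sym (*-identityˡ y) ⟩
    1F *F y        ≡⟨ cong (_*F y) (trans (sym a⁻¹a≡1) (*-comm a a⁻¹)) ⟩
    (a⁻¹ *F a) *F y ≡⟨ *-assoc a⁻¹ a y ⟩
    a⁻¹ *F (a *F y) ≡⟨ cong (a⁻¹ *F_) ay≡0 ⟩
    a⁻¹ *F 0F      ≡⟨ zeroʳ a⁻¹ ⟩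
    0F             ∎
    where
    a⁻¹ = proj₁ (inverse a a≢0)
    a⁻¹a≡1 = proj₂ (inverse a a≢0)

  linearRoot : (b a : Carrier) → ¬ a ≡ 0F → Carrier
  linearRoot b a a≢0 = (-F b) *F proj₁ (inverse a a≢0)

  linearRoot-root : ∀ b a a≢0 → b +F (linearRoot b a a≢0 *F a) ≡ 0F
  linearRoot-root b a a≢0 = begin
    b +F (((-F b) *F a⁻¹) *F a) ≡⟨ cong (b +F_) (*-assoc (-F b) a⁻¹ a) ⟩
    b +F ((-F b) *F (a⁻¹ *F a)) ≡⟨ cong (λ z → b +F ((-F b) *F z)) (trans (*-comm a⁻¹ a) aa⁻¹≡1) ⟩
    b +F ((-F b) *F 1F)        ≡⟨ cong (b +F_) (*-identityʳ (-F b)) ⟩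
    b +F (-F b)                ≡⟨ -‿inverseʳ b ⟩
    0F                         ∎
    where
    a⁻¹ = proj₁ (inverse a a≢0)
    aa⁻¹≡1 = proj₂ (inverse a a≢0)

  linearRoot-unique : ∀ b a a≢0 l → b +F (l *F a) ≡ 0F → l ≡ linearRoot b a a≢0
  linearRoot-unique b a a≢0 l b+la≡0 = begin
    l                 ≡⟨ sym (*-identityʳ l) ⟩
    l *F 1F           ≡⟨ cong (l *F_) (sym aa⁻¹≡1) ⟩
    l *F (a *F a⁻¹)   ≡⟨ sym (*-assoc l a a⁻¹) ⟩
    (l *F a) *F a⁻¹   ≡⟨ cong (_*F a⁻¹) (inverseʳ-unique b (l *F a) b+la≡0) ⟩
    (-F b) *F a⁻¹     ∎
    where
    a⁻¹ = proj₁ (inverse a a≢0)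
    aa⁻¹≡1 = proj₂ (inverse a a≢0)

  dot : ∀ {k} → Vector Carrier k → Vector Carrier k → Carrier
  dot {k} a v = ΣF k (λ j → a j *F v j)

  ΣF≡sum : ∀ m (f : Vector Carrier m) → ΣF m f ≡ FΣ.sum f
  ΣF≡sum zero    f = refl
  ΣF≡sum (suc m) f = cong (f zero +F_) (ΣF≡sum m (f ∘ suc))

  dot-linearˡ : ∀ {k} (b a : Vector Carrier k) l v →
    dot (λ j → b j +F (l *F a j)) v ≡ dot b v +F (l *F dot a v)
  dot-linearˡ {k} b a l v = begin
    ΣF k (λ j → (b j +F (l *F a j)) *F v j)
      ≡⟨ ΣF≡sum k _ ⟩
    FΣ.sum (λ j → (b j +F (l *F a j)) *F v j)
      ≡⟨ FΣ.sum-cong-≗ (λ j → trans (distribʳ (v j) (b j) _) (cong ((b j *F v j) +F_) (*-assoc l (a j) (v j)))) ⟩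
    FΣ.sum (λ j → (b j *F v j) +F (l *F (a j *F v j)))
      ≡⟨ FΣ.∑-distrib-+ (λ j → b j *F v j) (λ j → l *F (a j *F v j)) ⟩
    FΣ.sum (λ j → b j *F v j) +F FΣ.sum (λ j → l *F (a j *F v j))
      ≡⟨ cong₂ _+F_ (sym (ΣF≡sum k (λ j → b j *F v j))) (sym (FΣ.*-distribˡ-sum l (λ j → a j *F v j))) ⟩
    dot b v +F (l *F FΣ.sum (λ j → a j *F v j))
      ≡⟨ cong (λ s → dot b v +F (l *F s)) (sym (ΣF≡sum k _)) ⟩
    dot b v +F (l *F dot a v) ∎

  dot-zeroˡ : ∀ {k} (a : Vector Carrier k) → (∀ j → a j ≡ 0F) → ∀ v → dot a v ≡ 0F
  dot-zeroˡ {k} a a≡0 v = begin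
    ΣF k (λ j → a j *F v j) ≡⟨ ΣF≡sum k _ ⟩
    FΣ.sum (λ j → a j *F v j) ≡⟨ FΣ.sum-cong-≗ (λ j → trans (cong (_*F v j) (a≡0 j)) (zeroˡ (v j))) ⟩
    FΣ.sum {k} (λ _ → 0F) ≡⟨ FΣ.sum-replicate-zero k ⟩
    0F ∎

  NonzeroVector : ∀ {m} → Vector Carrier m → Set
  NonzeroVector a = ∃ λ j → ¬ a j ≡ 0F

  dot≢0⇒nonzeroVector : ∀ {k} (a v : Vector Carrier k) → ¬ dot a v ≡ 0F → NonzeroVector a
  dot≢0⇒nonzeroVector {k} a v dot≢0 with Finₚ.all? (λ j → a j ≟F 0F)
  ... | yes a≡0 = ⊥-elim (dot≢0 (dot-zeroˡ a a≡0 v))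
  ... | no  a≢0 = Finₚ.¬∀⟶∃¬ k _ (λ j → a j ≟F 0F) a≢0

  dot-congˡ : ∀ {k} {a b : Vector Carrier k} → a ≗ b → ∀ v → dot a v ≡ dot b v
  dot-congˡ {k} {a} {b} a≗b v = begin
    ΣF k (λ j → a j *F v j)   ≡⟨ ΣF≡sum k _ ⟩
    FΣ.sum (λ j → a j *F v j) ≡⟨ FΣ.sum-cong-≗ (λ j → cong (_*F v j) (a≗b j)) ⟩
    FΣ.sum (λ j → b j *F v j) ≡⟨ sym (ΣF≡sum k _) ⟩
    ΣF k (λ j → b j *F v j)   ∎

  dot-insertAt-0 : ∀ {k} (b : Vector Carrier k) j v → dot (insertAt b j 0F) v ≡ dot b (removeAt v j)
  dot-insertAt-0 {k} b j v = begin
    ΣF (suc k) (λ x → insertAt b j 0F x *F v x)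
      ≡⟨ ΣF≡sum (suc k) f ⟩
    FΣ.sum f
      ≡⟨ FΣ.sum-remove {i = j} f ⟩
    (insertAt b j 0F j *F v j) +F FΣ.sum (λ x → insertAt b j 0F (punchIn j x) *F v (punchIn j x))
      ≡⟨ cong₂ _+F_ (trans (cong (_*F v j) (insertAt-lookup b j 0F)) (zeroˡ (v j)))
                    (FΣ.sum-cong-≗ (λ x → cong (_*F v (punchIn j x)) (insertAt-punchIn b j 0F x))) ⟩
    0F +F FΣ.sum (λ x → b x *F removeAt v j x)
      ≡⟨ trans (+-identityˡ _) (sym (ΣF≡sum k _)) ⟩
    dot b (removeAt v j) ∎
    where
    f : Vector Carrier (suc k)
    f x = insertAt b j 0F x *F v x

  𝟙[≢0] : Carrier → ℕ
  𝟙[≢0] x with x ≟F 0F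
  ... | yes _ = 0
  ... | no  _ = 1

  𝟙[≡0] : Carrier → ℕ
  𝟙[≡0] x with x ≟F 0F
  ... | yes _ = 1
  ... | no  _ = 0

  𝟙[≢0]+𝟙[≡0] : ∀ x → 𝟙[≢0] x + 𝟙[≡0] x ≡ 1
  𝟙[≢0]+𝟙[≡0] x with x ≟F 0F
  ... | yes _ = refl
  ... | no  _ = refl

  𝟙[≢0]-≡0 : ∀ {x} → x ≡ 0F → 𝟙[≢0] x ≡ 0
  𝟙[≢0]-≡0 {x} x≡0 with x ≟F 0F
  ... | yes _   = refl
  ... | no  x≢0 = ⊥-elim (x≢0 x≡0)

  𝟙[≢0]-≢0 : ∀ {x} → ¬ x ≡ 0F → 𝟙[≢0] x ≡ 1
  𝟙[≢0]-≢0 {x} x≢0 with x ≟F 0F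
  ... | yes x≡0 = ⊥-elim (x≢0 x≡0)
  ... | no  _   = refl

  𝟙[≢0]≤1 : ∀ x → 𝟙[≢0] x ≤ 1
  𝟙[≢0]≤1 x with x ≟F 0F
  ... | yes _ = z≤n
  ... | no  _ = s≤s z≤n

  weight≡sum : ∀ {n} (c : Word n) → weight c ≡ sum (𝟙[≢0] ∘ c)
  weight≡sum {zero}  c = refl
  weight≡sum {suc n} c with c zero ≟F 0F
  ... | yes _ = weight≡sum (c ∘ suc)
  ... | no  _ = cong suc (weight≡sum (c ∘ suc))

  instance
    q-nonZero : NonZero q
    q-nonZero = Finₚ.nonZeroIndex (to 0F)

  ∑ᶠ : (Carrier → ℕ) → ℕ
  ∑ᶠ f = sum (f ∘ from)

  ∑ᶠ-cong : ∀ {f g} → (∀ x → f x ≡ g x) → ∑ᶠ f ≡ ∑ᶠ g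
  ∑ᶠ-cong f≗g = sum-cong-≗ (f≗g ∘ from)

  ∑ᶠ-const : ∀ c → ∑ᶠ (λ _ → c) ≡ q * c
  ∑ᶠ-const = sum-const q

  linear-zeros : ∀ b a → ¬ a ≡ 0F → ∑ᶠ (λ l → 𝟙[≡0] (b +F (l *F a))) ≡ 1
  linear-zeros b a a≢0 = trans (sum-cong-≗ zero-at-root) (sum-𝟙≡ (to r))
    where
    r = linearRoot b a a≢0
    zero-at-root : ∀ t → 𝟙[≡0] (b +F (from t *F a)) ≡ 𝟙[ t ≡ to r ]
    zero-at-root t with (b +F (from t *F a)) ≟F 0F | t Finₚ.≟ to r
    ... | yes _     | yes _    = refl
    ... | no  _     | no  _    = refl
    ... | yes isRoot | no t≢r  =
      ⊥-elim (t≢r (trans (sym (strictlyInverseˡ t)) (cong to (linearRoot-unique b a a≢0 (from t) isRoot))))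
    ... | no notRoot | yes t≡r =
      ⊥-elim (notRoot (subst (λ l → b +F (l *F a) ≡ 0F)
                             (sym (trans (cong from t≡r) (strictlyInverseʳ r))) (linearRoot-root b a a≢0)))

  linear-nonzeros : ∀ b a → ¬ a ≡ 0F → ∑ᶠ (λ l → 𝟙[≢0] (b +F (l *F a))) + 1 ≡ q
  linear-nonzeros b a a≢0 = begin
    ∑ᶠ (λ l → 𝟙[≢0] (f l)) + 1                   ≡⟨ cong (∑ᶠ (λ l → 𝟙[≢0] (f l)) +_) (sym (linear-zeros b a a≢0)) ⟩
    ∑ᶠ (λ l → 𝟙[≢0] (f l)) + ∑ᶠ (λ l → 𝟙[≡0] (f l)) ≡⟨ sym (∑-distrib-+ (𝟙[≢0] ∘ f ∘ from) (𝟙[≡0] ∘ f ∘ from)) ⟩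
    ∑ᶠ (λ l → 𝟙[≢0] (f l) + 𝟙[≡0] (f l))          ≡⟨ sum-cong-≗ (𝟙[≢0]+𝟙[≡0] ∘ f ∘ from) ⟩
    ∑ᶠ (λ _ → 1)                                  ≡⟨ trans (∑ᶠ-const 1) (ℕₚ.*-identityʳ q) ⟩
    q                                             ∎
    where
    f : Carrier → Carrier
    f l = b +F (l *F a)

  -- Codes restricted to a set of coordinates

  -- A set of coordinates is a Boolean vector S; restricting to S replaces puncturing, so that the
  -- length stays fixed along the induction.
  module _ {n : ℕ} where

    wt[_] : Vector Bool n → Word n → ℕ
    wt[ S ] c = sum (λ i → if S i then 𝟙[≢0] (c i) else 0)

    size : Vector Bool n → ℕ
    size S = sum (λ i → if S i then 1 else 0)

    full : Vector Bool n
    full _ = true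

    _∖supp_ : Vector Bool n → Word n → Vector Bool n
    (S ∖supp c) i = S i ∧ does (c i ≟F 0F)

    size-∖supp : ∀ S c → size S ≡ wt[ S ] c + size (S ∖supp c)
    size-∖supp S c = trans (sum-cong-≗ (λ i → split (S i) (c i)))
      (∑-distrib-+ (λ i → if S i then 𝟙[≢0] (c i) else 0) (λ i → if (S ∖supp c) i then 1 else 0))
      where
      split : ∀ s x → (if s then 1 else 0) ≡ (if s then 𝟙[≢0] x else 0) + (if s ∧ does (x ≟F 0F) then 1 else 0)
      split false x = refl
      split true  x with x ≟F 0F
      ... | yes _ = refl
      ... | no  _ = refl

    wt-cong : ∀ S {u v} → u ≗ v → wt[ S ] u ≡ wt[ S ] v
    wt-cong S u≗v = sum-cong-≗ λ i → cong (λ x → if S i then 𝟙[≢0] x else 0) (u≗v i)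

    ∖supp-intro : ∀ S c {i} → S i ≡ true → c i ≡ 0F → (S ∖supp c) i ≡ true
    ∖supp-intro S c {i} i∈S ci≡0 with c i ≟F 0F
    ... | yes _    = cong (_∧ true) i∈S
    ... | no ci≢0 = ⊥-elim (ci≢0 ci≡0)

    VanishesOn : Vector Bool n → Word n → Set
    VanishesOn S c = ∀ i → S i ≡ true → c i ≡ 0F

    NonzeroOn : Vector Bool n → Word n → Set
    NonzeroOn S c = ∃ λ i → S i ≡ true × ¬ c i ≡ 0F

    _⊆[_]_ : Word n → Vector Bool n → Word n → Set
    u ⊆[ S ] c = ∀ i → S i ≡ true → c i ≡ 0F → u i ≡ 0F

    _⊂[_]_ : Word n → Vector Bool n → Word n → Set
    u ⊂[ S ] c = NonzeroOn S u × u ⊆[ S ] c × ∃ λ i → S i ≡ true × ¬ c i ≡ 0F × u i ≡ 0F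

    nonzeroOn? : ∀ S c → Dec (NonzeroOn S c)
    nonzeroOn? S c = Finₚ.any? (λ i → (S i Bool.≟ true) ×-dec ¬? (c i ≟F 0F))

    ⊂[_]? : ∀ S u c → Dec (u ⊂[ S ] c)
    ⊂[ S ]? u c = nonzeroOn? S u
      ×-dec Finₚ.all? (λ i → (S i Bool.≟ true) →-dec (c i ≟F 0F) →-dec (u i ≟F 0F))
      ×-dec Finₚ.any? (λ i → (S i Bool.≟ true) ×-dec ¬? (c i ≟F 0F) ×-dec (u i ≟F 0F))

    ⊂-respˡ : ∀ {S u u′ c} → u ≗ u′ → u ⊂[ S ] c → u′ ⊂[ S ] c
    ⊂-respˡ u≗u′ ((i , i∈S , ui≢0) , u⊆c , (j , j∈S , cj≢0 , uj≡0)) =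
      (i , i∈S , ui≢0 ∘ trans (u≗u′ i)) ,
      (λ i i∈S ci≡0 → trans (sym (u≗u′ i)) (u⊆c i i∈S ci≡0)) ,
      (j , j∈S , cj≢0 , trans (sym (u≗u′ j)) uj≡0)

    ¬nonzeroOn⇒vanishesOn : ∀ {S c} → ¬ NonzeroOn S c → VanishesOn S c
    ¬nonzeroOn⇒vanishesOn {S} {c} ¬nz i i∈S with c i ≟F 0F
    ... | yes ci≡0 = ci≡0
    ... | no  ci≢0 = ⊥-elim (¬nz (i , i∈S , ci≢0))

    wt-pos : ∀ S c → NonzeroOn S c → 1 ≤ wt[ S ] c
    wt-pos S c (i , i∈S , ci≢0) = ℕₚ.≤-trans 1≤term (≤-sum (λ i → if S i then 𝟙[≢0] (c i) else 0) i)
      where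
      1≤term : 1 ≤ (if S i then 𝟙[≢0] (c i) else 0)
      1≤term rewrite i∈S | 𝟙[≢0]-≢0 ci≢0 = s≤s z≤n

    wt-mono-< : ∀ S u c → u ⊂[ S ] c → wt[ S ] u < wt[ S ] c
    wt-mono-< S u c (_ , u⊆c , i , i∈S , ci≢0 , ui≡0) = sum-mono-< termwise i strict
      where
      termwise : ∀ i → (if S i then 𝟙[≢0] (u i) else 0) ≤ (if S i then 𝟙[≢0] (c i) else 0)
      termwise i with S i in i∈S
      ... | false = z≤n
      ... | true with c i ≟F 0F
      ...   | yes ci≡0 = ℕₚ.≤-reflexive (𝟙[≢0]-≡0 (u⊆c i i∈S ci≡0))
      ...   | no  _    = 𝟙[≢0]≤1 (u i)
      strict : (if S i then 𝟙[≢0] (u i) else 0) < (if S i then 𝟙[≢0] (c i) else 0)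
      strict rewrite i∈S | 𝟙[≢0]-≡0 ui≡0 | 𝟙[≢0]-≢0 ci≢0 = s≤s z≤n

  ∃-element? : ∀ {P : Carrier → Set} → (∀ x → Dec (P x)) → Dec (∃ P)
  ∃-element? {P} P? = map′ (λ (t , p) → from t , p)
    (λ (x , p) → to x , subst P (sym (strictlyInverseʳ x)) p) (Finₚ.any? (P? ∘ from))

  -- Functions are not extensional, so P has to respect pointwise equality.
  ∃-vector? : ∀ m {P : Vector Carrier m → Set} → (∀ {v w} → v ≗ w → P v → P w) →
    (∀ v → Dec (P v)) → Dec (∃ P)
  ∃-vector? zero    resp P? = map′ (λ p → []ᵛ , p) (λ (v , p) → resp (λ ()) p) (P? []ᵛ)
  ∃-vector? (suc m) resp P? =
    map′ (λ (x , v , p) → (x ∷ᵛ v) , p)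
         (λ (w , p) → head w , tail w , resp (λ { zero → refl ; (suc i) → refl }) p)
         (∃-element? (λ x → ∃-vector? m (λ v≗w → resp (λ { zero → refl ; (suc i) → v≗w i })) (P? ∘ (x ∷ᵛ_))))

  module _ {n k : ℕ} (S : Vector Bool n) (g : Fin k → Word n) where

    IndependentOn : Set
    IndependentOn = ∀ a → VanishesOn S (comb a g) → ∀ j → a j ≡ 0F

    DivisibleOn : ℕ → Set
    DivisibleOn Δ = ∀ a → Δ ∣ wt[ S ] (comb a g)

    MinimalOn : Vector Carrier k → Set
    MinimalOn a = ∀ b → comb b g ⊆[ S ] comb a g →
      ∃ λ μ → ∀ i → S i ≡ true → comb b g i ≡ μ *F comb a g i

    -- If u ⊆ c on S and u i₀ ≢ 0, then u + λc with λ killing coordinate i₀ would be a proper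
    -- subword of c, so it vanishes on S and u = −λc there.
    no-proper-subword⇒minimalOn : ∀ a → ¬ (∃ λ b → comb b g ⊂[ S ] comb a g) → MinimalOn a
    no-proper-subword⇒minimalOn a ¬proper b u⊆c with nonzeroOn? S (comb b g)
    ... | no ¬nz = 0F , λ i i∈S → trans (¬nonzeroOn⇒vanishesOn ¬nz i i∈S) (sym (zeroˡ _))
    ... | yes (i₀ , i₀∈S , ui₀≢0) = -F l , u≡-lc
      where
      u = comb b g
      c = comb a g
      ci₀≢0 : ¬ c i₀ ≡ 0F
      ci₀≢0 ci₀≡0 = ui₀≢0 (u⊆c i₀ i₀∈S ci₀≡0)
      l = linearRoot (u i₀) (c i₀) ci₀≢0
      d = comb (λ j → b j +F (l *F a j)) g
      d≡u+lc : ∀ i → d i ≡ u i +F (l *F c i)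
      d≡u+lc i = dot-linearˡ b a l (λ j → g j i)
      d⊆c : d ⊆[ S ] c
      d⊆c i i∈S ci≡0 = begin
        d i                   ≡⟨ d≡u+lc i ⟩
        u i +F (l *F c i)     ≡⟨ cong₂ (λ x y → x +F (l *F y)) (u⊆c i i∈S ci≡0) ci≡0 ⟩
        0F +F (l *F 0F)       ≡⟨ trans (+-identityˡ _) (zeroʳ l) ⟩
        0F                    ∎
      d-vanishes : VanishesOn S d
      d-vanishes with nonzeroOn? S d
      ... | no ¬nz = ¬nonzeroOn⇒vanishesOn ¬nz
      ... | yes nz = ⊥-elim (¬proper (_ , nz , d⊆c , i₀ , i₀∈S , ci₀≢0 ,
                       trans (d≡u+lc i₀) (linearRoot-root (u i₀) (c i₀) ci₀≢0)))
      u≡-lc : ∀ i → S i ≡ true → u i ≡ (-F l) *F c i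
      u≡-lc i i∈S = trans (inverseʳ-unique (l *F c i) (u i) (trans (+-comm _ _) (trans (sym (d≡u+lc i)) (d-vanishes i i∈S))))
                          (-‿distribˡ-* l (c i))

    minimalOn-exists : ∀ a → NonzeroOn S (comb a g) → ∃ λ a′ → NonzeroOn S (comb a′ g) × MinimalOn a′
    minimalOn-exists a = descend a (<-wellFounded _)
      where
      descend : ∀ a → Acc _<_ (wt[ S ] (comb a g)) → NonzeroOn S (comb a g) →
        ∃ λ a′ → NonzeroOn S (comb a′ g) × MinimalOn a′
      descend a (acc smaller) nz
        with ∃-vector? k (λ b≗b′ → ⊂-respˡ (λ i → dot-congˡ b≗b′ (λ j → g j i))) (λ b → ⊂[ S ]? (comb b g) (comb a g))
      ... | yes (b , b⊂a) = descend b (smaller (wt-mono-< S _ _ b⊂a)) (proj₁ b⊂a)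
      ... | no  ¬proper   = a , nz , no-proper-subword⇒minimalOn a ¬proper

  module _ {n : ℕ} where

    residual-independent : ∀ {k} S (g : Fin (suc k) → Word n) a j → IndependentOn S g → MinimalOn S g a →
      ¬ a j ≡ 0F → IndependentOn (S ∖supp comb a g) (removeAt g j)
    residual-independent S g a j indep minimal aj≢0 b′ b′-vanishes i = begin
      b′ i                                           ≡⟨ insertAt-punchIn b′ j 0F i ⟨
      b (punchIn j i)                                ≡⟨ b-μa≡b (punchIn j i) ⟨
      b (punchIn j i) +F ((-F μ) *F a (punchIn j i)) ≡⟨ b-μa≡0 (punchIn j i) ⟩
      0F                                             ∎
      where
      c = comb a g
      b = insertAt b′ j 0F
      b⊆c : comb b g ⊆[ S ] c
      b⊆c i i∈S ci≡0 = trans (dot-insertAt-0 b′ j (λ x → g x i)) (b′-vanishes i (∖supp-intro S c i∈S ci≡0))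
      μ = proj₁ (minimal b b⊆c)
      b-μa≡0 : ∀ x → b x +F ((-F μ) *F a x) ≡ 0F
      b-μa≡0 = indep (λ x → b x +F ((-F μ) *F a x)) λ i i∈S → begin
        comb (λ x → b x +F ((-F μ) *F a x)) g i ≡⟨ dot-linearˡ b a (-F μ) (λ x → g x i) ⟩
        comb b g i +F ((-F μ) *F c i)         ≡⟨ cong (_+F ((-F μ) *F c i)) (proj₂ (minimal b b⊆c) i i∈S) ⟩
        (μ *F c i) +F ((-F μ) *F c i)         ≡⟨ sym (distribʳ (c i) μ (-F μ)) ⟩
        (μ +F (-F μ)) *F c i                  ≡⟨ cong (_*F c i) (-‿inverseʳ μ) ⟩
        0F *F c i                             ≡⟨ zeroˡ (c i) ⟩
        0F                                    ∎
      -μ≡0 : -F μ ≡ 0F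
      -μ≡0 = nonzero*≡0⇒≡0 aj≢0 (begin
        a j *F (-F μ)           ≡⟨ *-comm (a j) (-F μ) ⟩
        (-F μ) *F a j           ≡⟨ sym (+-identityˡ _) ⟩
        0F +F ((-F μ) *F a j)   ≡⟨ cong (_+F ((-F μ) *F a j)) (sym (insertAt-lookup b′ j 0F)) ⟩
        b j +F ((-F μ) *F a j)  ≡⟨ b-μa≡0 j ⟩
        0F                      ∎)
      b-μa≡b : ∀ x → b x +F ((-F μ) *F a x) ≡ b x
      b-μa≡b x = begin
        b x +F ((-F μ) *F a x) ≡⟨ cong (λ z → b x +F (z *F a x)) -μ≡0 ⟩
        b x +F (0F *F a x)     ≡⟨ cong (b x +F_) (zeroˡ (a x)) ⟩
        b x +F 0F              ≡⟨ +-identityʳ (b x) ⟩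
        b x                    ∎

  -- As λ runs over F, u + λc is nonzero q times if c ≡ 0 ≢ u, and q − 1 times if c ≢ 0.
  line-average : ∀ u c →
    ∑ᶠ (λ l → 𝟙[≢0] (u +F (l *F c))) + 𝟙[≢0] c ≡ q * (if does (c ≟F 0F) then 𝟙[≢0] u else 0) + q * 𝟙[≢0] c
  line-average u c with c ≟F 0F
  ... | yes c≡0 = begin
    ∑ᶠ (λ l → 𝟙[≢0] (u +F (l *F c))) + 0 ≡⟨ ℕₚ.+-identityʳ _ ⟩
    ∑ᶠ (λ l → 𝟙[≢0] (u +F (l *F c)))     ≡⟨ sum-cong-≗ (λ t → cong 𝟙[≢0] (u+lc≡u (from t))) ⟩
    ∑ᶠ (λ _ → 𝟙[≢0] u)                   ≡⟨ ∑ᶠ-const (𝟙[≢0] u) ⟩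
    q * 𝟙[≢0] u                          ≡⟨ ℕₚ.+-identityʳ _ ⟨
    q * 𝟙[≢0] u + 0                      ≡⟨ cong (q * 𝟙[≢0] u +_) (ℕₚ.*-zeroʳ q) ⟨
    q * 𝟙[≢0] u + q * 0                  ∎
    where
    u+lc≡u : ∀ l → u +F (l *F c) ≡ u
    u+lc≡u l = trans (cong (λ z → u +F (l *F z)) c≡0) (trans (cong (u +F_) (zeroʳ l)) (+-identityʳ u))
  ... | no c≢0 = begin
    ∑ᶠ (λ l → 𝟙[≢0] (u +F (l *F c))) + 1 ≡⟨ linear-nonzeros u c c≢0 ⟩
    q                                    ≡⟨ ℕₚ.*-identityʳ q ⟨
    q * 1                                ≡⟨ cong (_+ q * 1) (ℕₚ.*-zeroʳ q) ⟨
    q * 0 + q * 1                        ∎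

  module _ {n : ℕ} where

    wt-average : ∀ S (u c : Word n) →
      ∑ᶠ (λ l → wt[ S ] (λ i → u i +F (l *F c i))) + wt[ S ] c ≡ q * wt[ S ∖supp c ] u + q * wt[ S ] c
    wt-average S u c = begin
      ∑ᶠ (λ l → sum (λ i → line l i)) + sum M
        ≡⟨ cong (_+ sum M) (∑-comm (λ t i → line (from t) i)) ⟩
      sum (λ i → ∑ᶠ (λ l → line l i)) + sum M
        ≡⟨ ∑-distrib-+ (λ i → ∑ᶠ (λ l → line l i)) M ⟨
      sum (λ i → ∑ᶠ (λ l → line l i) + M i)
        ≡⟨ sum-cong-≗ (λ i → masked-line-average (S i) (u i) (c i)) ⟩
      sum (λ i → q * R i + q * M i)
        ≡⟨ ∑-distrib-+ (λ i → q * R i) (λ i → q * M i) ⟩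
      sum (λ i → q * R i) + sum (λ i → q * M i)
        ≡⟨ cong₂ _+_ (*-distribˡ-sum q R) (*-distribˡ-sum q M) ⟨
      q * wt[ S ∖supp c ] u + q * wt[ S ] c ∎
      where
      line : Carrier → Fin n → ℕ
      line l i = if S i then 𝟙[≢0] (u i +F (l *F c i)) else 0
      M R : Fin n → ℕ
      M i = if S i then 𝟙[≢0] (c i) else 0
      R i = if (S ∖supp c) i then 𝟙[≢0] (u i) else 0
      masked-line-average : ∀ s x y →
        ∑ᶠ (λ l → if s then 𝟙[≢0] (x +F (l *F y)) else 0) + (if s then 𝟙[≢0] y else 0)
          ≡ q * (if s ∧ does (y ≟F 0F) then 𝟙[≢0] x else 0) + q * (if s then 𝟙[≢0] y else 0)
      masked-line-average false x y =
        trans (ℕₚ.+-identityʳ _) (trans (sum-replicate-zero q) (sym (cong₂ _+_ (ℕₚ.*-zeroʳ q) (ℕₚ.*-zeroʳ q))))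
      masked-line-average true  x y = line-average x y

    residual-divisible : ∀ {k} s S (g : Fin k → Word n) a →
      DivisibleOn S g (q ^ s) → DivisibleOn (S ∖supp comb a g) g (q ^ (s ∸ 1))
    residual-divisible zero    S g a divisible b = ∣ₚ.1∣ _
    residual-divisible (suc s) S g a divisible b = ∣ₚ.*-cancelˡ-∣ q q·q^s∣q·w′
      where
      u = comb b g
      c = comb a g
      w′ = wt[ S ∖supp c ] u
      w  = wt[ S ] c
      q^s∣average : q ^ suc s ∣ ∑ᶠ (λ l → wt[ S ] (λ i → u i +F (l *F c i))) + w
      q^s∣average = ∣ₚ.∣m∣n⇒∣m+n
        (∣-sum _ λ t → subst (q ^ suc s ∣_)
          (wt-cong S (λ i → dot-linearˡ b a (from t) (λ j → g j i)))
          (divisible (λ j → b j +F (from t *F a j))))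
        (divisible a)
      q·q^s∣q·w′ : q * q ^ s ∣ q * w′
      q·q^s∣q·w′ = ∣ₚ.∣m+n∣m⇒∣n
        (subst (q ^ suc s ∣_) (trans (wt-average S u c) (ℕₚ.+-comm (q * w′) (q * w))) q^s∣average)
        (∣ₚ.∣n⇒∣m*n q (divisible a))

  divisibleOn-removeAt : ∀ {n k Δ} S (g : Fin (suc k) → Word n) j → DivisibleOn S g Δ → DivisibleOn S (removeAt g j) Δ
  divisibleOn-removeAt {Δ = Δ} S g j divisible b′ =
    subst (Δ ∣_) (wt-cong S (λ i → dot-insertAt-0 b′ j (λ x → g x i))) (divisible (insertAt b′ j 0F))

  -- The length bound for divisible codes

  -- [ k ]q = 1 + q + ⋯ + q^(k−1) = (q^k − 1)/(q − 1), the number of points of PG(k−1,q).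
  [_]q : ℕ → ℕ
  [ zero  ]q = 0
  [ suc k ]q = q ^ k + [ k ]q

  [suc]q-split : ∀ {k s} → k ≤ s → q ^ (s ∸ k) * [ suc k ]q ≡ q ^ s + q ^ ((s ∸ 1) ∸ (k ∸ 1)) * [ k ]q
  [suc]q-split {zero} {s} _ = begin
    q ^ s * (1 + 0)       ≡⟨ ℕₚ.*-identityʳ (q ^ s) ⟩
    q ^ s                 ≡⟨ ℕₚ.+-identityʳ (q ^ s) ⟨
    q ^ s + 0             ≡⟨ cong (q ^ s +_) (ℕₚ.*-zeroʳ (q ^ (s ∸ 1))) ⟨
    q ^ s + q ^ (s ∸ 1) * 0 ∎
  [suc]q-split {suc k} {suc s} (s≤s k≤s) = begin
    q ^ (s ∸ k) * (q ^ suc k + [ suc k ]q)               ≡⟨ ℕₚ.*-distribˡ-+ (q ^ (s ∸ k)) _ _ ⟩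
    q ^ (s ∸ k) * q ^ suc k + q ^ (s ∸ k) * [ suc k ]q   ≡⟨ cong (_+ q ^ (s ∸ k) * [ suc k ]q) (^-∸-* q (s≤s k≤s)) ⟩
    q ^ suc s + q ^ (s ∸ k) * [ suc k ]q                 ∎

  [_]q*[q-1] : ∀ k → [ k ]q * (q ∸ 1) ≡ q ^ k ∸ 1
  [ zero  ]q*[q-1] = refl
  [ suc k ]q*[q-1] = begin
    (q ^ k + [ k ]q) * (q ∸ 1)             ≡⟨ ℕₚ.*-distribʳ-+ (q ∸ 1) (q ^ k) [ k ]q ⟩
    q ^ k * (q ∸ 1) + [ k ]q * (q ∸ 1)     ≡⟨ cong₂ _+_ (ℕₚ.*-distribˡ-∸ (q ^ k) q 1) [ k ]q*[q-1] ⟩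
    (q ^ k * q ∸ q ^ k * 1) + (q ^ k ∸ 1)  ≡⟨ cong (λ z → (q ^ k * q ∸ z) + (q ^ k ∸ 1)) (ℕₚ.*-identityʳ (q ^ k)) ⟩
    (q ^ k * q ∸ q ^ k) + (q ^ k ∸ 1)      ≡⟨ ℕₚ.+-∸-assoc (q ^ k * q ∸ q ^ k) (ℕₚ.m^n>0 q k) ⟨
    ((q ^ k * q ∸ q ^ k) + q ^ k) ∸ 1      ≡⟨ cong (_∸ 1) (ℕₚ.m∸n+n≡m (ℕₚ.m≤m*n (q ^ k) q)) ⟩
    q ^ k * q ∸ 1                          ≡⟨ cong (_∸ 1) (ℕₚ.*-comm (q ^ k) q) ⟩
    q ^ suc k ∸ 1                          ∎

  size-lowerBound : ∀ {n} k s S (g : Fin k → Word n) → k ∸ 1 ≤ s → IndependentOn S g → DivisibleOn S g (q ^ s) →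
    q ^ (s ∸ (k ∸ 1)) * [ k ]q ≤ size S
  size-lowerBound zero    s S g _ _ _ = subst (_≤ size S) (sym (ℕₚ.*-zeroʳ (q ^ s))) z≤n
  size-lowerBound (suc k) s S g k≤s independent divisible =
    subst₂ _≤_ (sym ([suc]q-split k≤s)) (sym (size-∖supp S c)) (ℕₚ.+-mono-≤ q^s≤wt residual-bound)
    where
    ones-nonzeroOn : NonzeroOn S (comb (λ _ → 1F) g)
    ones-nonzeroOn with nonzeroOn? S (comb (λ _ → 1F) g)
    ... | yes nz  = nz
    ... | no  ¬nz = ⊥-elim (0≢1 (sym (independent (λ _ → 1F) (¬nonzeroOn⇒vanishesOn ¬nz) zero)))
    minimalCodeword = minimalOn-exists S g (λ _ → 1F) ones-nonzeroOn
    a = proj₁ minimalCodeword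
    c = comb a g
    c-nonzeroOn : NonzeroOn S c
    c-nonzeroOn = proj₁ (proj₂ minimalCodeword)
    some-aj≢0 : NonzeroVector a
    some-aj≢0 = let (i , _ , ci≢0) = c-nonzeroOn in dot≢0⇒nonzeroVector a (λ j → g j i) ci≢0
    j = proj₁ some-aj≢0
    q^s≤wt : q ^ s ≤ wt[ S ] c
    q^s≤wt = ∣ₚ.∣⇒≤ {{>-nonZero (wt-pos S c c-nonzeroOn)}} (divisible a)
    residual-bound : q ^ ((s ∸ 1) ∸ (k ∸ 1)) * [ k ]q ≤ size (S ∖supp c)
    residual-bound = size-lowerBound k (s ∸ 1) (S ∖supp c) (removeAt g j) (ℕₚ.∸-monoˡ-≤ 1 k≤s)
      (residual-independent S g a j independent (proj₂ (proj₂ minimalCodeword)) (proj₂ some-aj≢0))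
      (divisibleOn-removeAt (S ∖supp c) g j (residual-divisible s S g a divisible))

  length-lowerBound : ∀ {n k s} → k ∸ 1 ≤ s → (C : LinearCode n k) → IsDivisible (q ^ s) C →
    q ^ (s ∸ (k ∸ 1)) * [ k ]q ≤ n
  length-lowerBound {n} {k} {s} k-1≤s C divisible =
    subst (_ ≤_) (trans (sum-const n 1) (ℕₚ.*-identityʳ n))
      (size-lowerBound k s full G k-1≤s (λ a aG≡0 → indep a (λ i → aG≡0 i refl))
                             (λ a → subst (q ^ s ∣_) (weight≡sum (comb a G)) (divisible (comb a G) (a , λ _ → refl))))
    where open LinearCode C renaming (basis to G)

  -- Replicated simplex codes

  vectors : ∀ m → List (Vector Carrier m)
  vectors zero    = []ᵛ ∷ []
  vectors (suc m) = concatMap (λ x → map (x ∷ᵛ_) (vectors m)) (tabulate from)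

  sumₗ-vectors-suc : ∀ m f → sumₗ f (vectors (suc m)) ≡ ∑ᶠ (λ x → sumₗ (f ∘ (x ∷ᵛ_)) (vectors m))
  sumₗ-vectors-suc m f = begin
    sumₗ f (vectors (suc m))                                  ≡⟨ sumₗ-concatMap f _ (tabulate from) ⟩
    sumₗ (λ x → sumₗ f (map (x ∷ᵛ_) (vectors m))) (tabulate from) ≡⟨ sumₗ-cong (λ x → sumₗ-map f (x ∷ᵛ_) (vectors m)) (tabulate from) ⟩
    sumₗ (λ x → sumₗ (f ∘ (x ∷ᵛ_)) (vectors m)) (tabulate from) ≡⟨ sumₗ-tabulate _ from ⟩
    ∑ᶠ (λ x → sumₗ (f ∘ (x ∷ᵛ_)) (vectors m))                 ∎

  #vectors : ∀ m → sumₗ (λ _ → 1) (vectors m) ≡ q ^ m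
  #vectors zero    = refl
  #vectors (suc m) = trans (sumₗ-vectors-suc m _) (trans (∑ᶠ-cong (λ _ → #vectors m)) (∑ᶠ-const (q ^ m)))

  -- The vectors whose first nonzero coordinate is 1, one for each point of PG(k−1,q).
  points : ∀ k → List (Vector Carrier k)
  points zero    = []
  points (suc k) = map (1F ∷ᵛ_) (vectors k) ++ map (0F ∷ᵛ_) (points k)

  #points : ∀ k → sumₗ (λ _ → 1) (points k) ≡ [ k ]q
  #points zero    = refl
  #points (suc k) = trans (sumₗ-++ _ (map (1F ∷ᵛ_) (vectors k)) _)
    (cong₂ _+_ (trans (sumₗ-map _ (1F ∷ᵛ_) (vectors k)) (#vectors k))
               (trans (sumₗ-map _ (0F ∷ᵛ_) (points k)) (#points k)))

  head≢0 : ∀ {m} {a : Vector Carrier (suc m)} → NonzeroVector a → (∀ j → tail a j ≡ 0F) → ¬ head a ≡ 0F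
  head≢0 (zero  , a₀≢0) tail≡0 = a₀≢0
  head≢0 (suc j , aj≢0) tail≡0 = λ _ → aj≢0 (tail≡0 j)

  tail-nonzero : ∀ {m} (a : Vector Carrier (suc m)) → ¬ (∀ j → tail a j ≡ 0F) → NonzeroVector (tail a)
  tail-nonzero {m} a tail≢0 = Finₚ.¬∀⟶∃¬ m _ (λ j → tail a j ≟F 0F) tail≢0

  q*q^pred : ∀ {m} → Fin m → q * q ^ (m ∸ 1) ≡ q ^ m
  q*q^pred {suc m} _ = refl

  affine-zeros : ∀ m (a : Vector Carrier m) → NonzeroVector a → ∀ b →
    sumₗ (λ v → 𝟙[≡0] (b +F dot a v)) (vectors m) ≡ q ^ (m ∸ 1)
  affine-zeros (suc m) a a≢0 b with Finₚ.all? (λ j → tail a j ≟F 0F)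
  ... | yes tail≡0 = begin
    sumₗ (λ v → 𝟙[≡0] (b +F dot a v)) (vectors (suc m))
      ≡⟨ sumₗ-vectors-suc m _ ⟩
    ∑ᶠ (λ x → sumₗ (λ v → 𝟙[≡0] (b +F ((head a *F x) +F dot (tail a) v))) (vectors m))
      ≡⟨ ∑ᶠ-cong (λ x → trans (sumₗ-cong (λ v → cong (λ y → 𝟙[≡0] (b +F y)) (dropTail x v)) (vectors m))
                                 (sumₗ-const _ (vectors m))) ⟩
    ∑ᶠ (λ x → length (vectors m) * 𝟙[≡0] (b +F (x *F head a)))
      ≡⟨ *-distribˡ-sum (length (vectors m)) (λ t → 𝟙[≡0] (b +F (from t *F head a))) ⟨
    length (vectors m) * ∑ᶠ (λ x → 𝟙[≡0] (b +F (x *F head a)))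
      ≡⟨ cong₂ _*_ (trans (length≡sumₗ-1 (vectors m)) (#vectors m)) (linear-zeros b (head a) (head≢0 a≢0 tail≡0)) ⟩
    q ^ m * 1
      ≡⟨ ℕₚ.*-identityʳ (q ^ m) ⟩
    q ^ m ∎
    where
    dropTail : ∀ x v → (head a *F x) +F dot (tail a) v ≡ x *F head a
    dropTail x v = trans (cong ((head a *F x) +F_) (dot-zeroˡ (tail a) tail≡0 v)) (trans (+-identityʳ _) (*-comm (head a) x))
  ... | no tail≢0 = begin
    sumₗ (λ v → 𝟙[≡0] (b +F dot a v)) (vectors (suc m))
      ≡⟨ sumₗ-vectors-suc m _ ⟩
    ∑ᶠ (λ x → sumₗ (λ v → 𝟙[≡0] (b +F ((head a *F x) +F dot (tail a) v))) (vectors m))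
      ≡⟨ ∑ᶠ-cong (λ x → trans (sumₗ-cong (λ v → cong 𝟙[≡0] (sym (+-assoc b (head a *F x) _))) (vectors m))
                              (affine-zeros m (tail a) tail≢0′ (b +F (head a *F x)))) ⟩
    ∑ᶠ (λ _ → q ^ (m ∸ 1))
      ≡⟨ ∑ᶠ-const (q ^ (m ∸ 1)) ⟩
    q * q ^ (m ∸ 1)
      ≡⟨ q*q^pred (proj₁ tail≢0′) ⟩
    q ^ m ∎
    where
    tail≢0′ = tail-nonzero a tail≢0

  affine-nonzeros : ∀ m (a : Vector Carrier m) → NonzeroVector a → ∀ b →
    sumₗ (λ v → 𝟙[≢0] (b +F dot a v)) (vectors m) + q ^ (m ∸ 1) ≡ q ^ m
  affine-nonzeros m a a≢0 b = begin
    sumₗ (𝟙[≢0] ∘ f) (vectors m) + q ^ (m ∸ 1)                   ≡⟨ cong (sumₗ (𝟙[≢0] ∘ f) (vectors m) +_) (affine-zeros m a a≢0 b) ⟨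
    sumₗ (𝟙[≢0] ∘ f) (vectors m) + sumₗ (𝟙[≡0] ∘ f) (vectors m)   ≡⟨ sumₗ-+ (𝟙[≢0] ∘ f) (𝟙[≡0] ∘ f) (vectors m) ⟨
    sumₗ (λ v → 𝟙[≢0] (f v) + 𝟙[≡0] (f v)) (vectors m)           ≡⟨ sumₗ-cong (𝟙[≢0]+𝟙[≡0] ∘ f) (vectors m) ⟩
    sumₗ (λ _ → 1) (vectors m)                                   ≡⟨ #vectors m ⟩
    q ^ m                                                        ∎
    where
    f : Vector Carrier m → Carrier
    f v = b +F dot a v

  points-nonorthogonal : ∀ k (a : Vector Carrier k) → NonzeroVector a →
    sumₗ (λ v → 𝟙[≢0] (dot a v)) (points k) ≡ q ^ (k ∸ 1)
  points-nonorthogonal (suc k) a a≢0 = begin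
    sumₗ (λ v → 𝟙[≢0] (dot a v)) (points (suc k))
      ≡⟨ sumₗ-++ _ (map (1F ∷ᵛ_) (vectors k)) _ ⟩
    sumₗ (λ v → 𝟙[≢0] (dot a v)) (map (1F ∷ᵛ_) (vectors k)) + sumₗ (λ v → 𝟙[≢0] (dot a v)) (map (0F ∷ᵛ_) (points k))
      ≡⟨ cong₂ _+_ (sumₗ-map _ (1F ∷ᵛ_) (vectors k))
                   (trans (sumₗ-map _ (0F ∷ᵛ_) (points k)) (sumₗ-cong (λ v → cong 𝟙[≢0] (head·0 v)) (points k))) ⟩
    sumₗ (λ v → 𝟙[≢0] ((head a *F 1F) +F dot (tail a) v)) (vectors k) + sumₗ (λ v → 𝟙[≢0] (dot (tail a) v)) (points k)
      ≡⟨ count (Finₚ.all? (λ j → tail a j ≟F 0F)) ⟩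
    q ^ k ∎
    where
    head·0 : ∀ v → (head a *F 0F) +F dot (tail a) v ≡ dot (tail a) v
    head·0 v = trans (cong (_+F dot (tail a) v) (zeroʳ (head a))) (+-identityˡ _)
    count : Dec (∀ j → tail a j ≡ 0F) →
      sumₗ (λ v → 𝟙[≢0] ((head a *F 1F) +F dot (tail a) v)) (vectors k) + sumₗ (λ v → 𝟙[≢0] (dot (tail a) v)) (points k)
        ≡ q ^ k
    count (no tail≢0) = trans (cong (sumₗ (λ v → 𝟙[≢0] ((head a *F 1F) +F dot (tail a) v)) (vectors k) +_)
                                    (points-nonorthogonal k (tail a) (tail-nonzero a tail≢0)))
                              (affine-nonzeros k (tail a) (tail-nonzero a tail≢0) (head a *F 1F))
    count (yes tail≡0) = begin
      sumₗ (λ v → 𝟙[≢0] ((head a *F 1F) +F dot (tail a) v)) (vectors k) + sumₗ (λ v → 𝟙[≢0] (dot (tail a) v)) (points k)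
        ≡⟨ cong₂ _+_ (sumₗ-cong (λ v → 𝟙[≢0]-≢0 (λ ≡0 → head≢0 a≢0 tail≡0 (trans (sym (onlyHead v)) ≡0))) (vectors k))
                     (sumₗ-cong (λ v → 𝟙[≢0]-≡0 (dot-zeroˡ (tail a) tail≡0 v)) (points k)) ⟩
      sumₗ (λ _ → 1) (vectors k) + sumₗ (λ _ → 0) (points k)
        ≡⟨ cong₂ _+_ (#vectors k) (trans (sumₗ-const 0 (points k)) (ℕₚ.*-zeroʳ (length (points k)))) ⟩
      q ^ k + 0
        ≡⟨ ℕₚ.+-identityʳ (q ^ k) ⟩
      q ^ k ∎
      where
      onlyHead : ∀ v → (head a *F 1F) +F dot (tail a) v ≡ head a
      onlyHead v = trans (cong ((head a *F 1F) +F_) (dot-zeroˡ (tail a) tail≡0 v)) (trans (+-identityʳ _) (*-identityʳ (head a)))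

  module _ {n : ℕ} where

    weight-cong : ∀ {c d : Word n} → c ≗ d → weight c ≡ weight d
    weight-cong {c} {d} c≗d = trans (weight≡sum c) (trans (sum-cong-≗ (cong 𝟙[≢0] ∘ c≗d)) (sym (weight≡sum d)))

    weight-zero : ∀ {c : Word n} → (∀ i → c i ≡ 0F) → weight c ≡ 0
    weight-zero {c} c≡0 = trans (weight≡sum c) (trans (sum-cong-≗ (𝟙[≢0]-≡0 ∘ c≡0)) (sum-replicate-zero n))

    ⊊supp⇒⊂[full] : ∀ {u c : Word n} → NonZeroWord u → u ⊊supp c → u ⊂[ full ] c
    ⊊supp⇒⊂[full] {u} {c} u≢0 (u⊆c , c⊈u) = u-nonzeroOn , u⊆[full]c , i , refl , ci≢0 , ui≡0
      where
      u-nonzeroOn : NonzeroOn full u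
      u-nonzeroOn = let (i , ui≢0) = Finₚ.¬∀⟶∃¬ n _ (λ i → u i ≟F 0F) u≢0 in i , refl , ui≢0
      u⊆[full]c : u ⊆[ full ] c
      u⊆[full]c i _ ci≡0 with u i ≟F 0F
      ... | yes ui≡0 = ui≡0
      ... | no  ui≢0 = ⊥-elim (u⊆c i ui≢0 ci≡0)
      witness = Finₚ.¬∀⟶∃¬ n _ (λ i → ¬? (c i ≟F 0F) →-dec ¬? (u i ≟F 0F)) c⊈u
      i = proj₁ witness
      ci≢0 : ¬ c i ≡ 0F
      ci≢0 ci≡0 = proj₂ witness (λ ci≢0 → ⊥-elim (ci≢0 ci≡0))
      ui≡0 : u i ≡ 0F
      ui≡0 with u i ≟F 0F
      ... | yes ui≡0 = ui≡0
      ... | no  ui≢0 = ⊥-elim (proj₂ witness (λ _ → ui≢0))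

    weight-mono-⊊supp : ∀ {u c : Word n} → NonZeroWord u → u ⊊supp c → weight u < weight c
    weight-mono-⊊supp {u} {c} u≢0 u⊊c =
      subst₂ _<_ (sym (weight≡sum u)) (sym (weight≡sum c)) (wt-mono-< full u c (⊊supp⇒⊂[full] u≢0 u⊊c))

  module ConstantWeight {n k : ℕ} (G : Fin k → Word n) (W : ℕ) .{{_ : NonZero W}}
    (weight-comb : ∀ a → NonzeroVector a → weight (comb a G) ≡ W) where

    independent : LinIndep G
    independent a aG≡0 j with a j ≟F 0F
    ... | yes aj≡0 = aj≡0
    ... | no  aj≢0 = ⊥-elim (≢-nonZero⁻¹ W (trans (sym (weight-comb a (j , aj≢0))) (weight-zero aG≡0)))

    code : LinearCode n k
    code = record { basis = G ; indep = independent }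

    coefficients-nonzero : ∀ {c a} → (∀ i → c i ≡ comb a G i) → NonZeroWord c → NonzeroVector a
    coefficients-nonzero {c} {a} c≡aG c≢0 =
      let (i , ci≢0) = Finₚ.¬∀⟶∃¬ n _ (λ i → c i ≟F 0F) c≢0
      in dot≢0⇒nonzeroVector a (λ j → G j i) (ci≢0 ∘ trans (c≡aG i))

    weight-codeword : ∀ c → c ∈C code → NonZeroWord c → weight c ≡ W
    weight-codeword c (a , c≡aG) c≢0 = trans (weight-cong c≡aG) (weight-comb a (coefficients-nonzero c≡aG c≢0))

    divisible : ∀ {Δ} → Δ ∣ W → IsDivisible Δ code
    divisible {Δ} Δ∣W c c∈C with Finₚ.all? (λ i → c i ≟F 0F)
    ... | yes c≡0 = subst (Δ ∣_) (sym (weight-zero c≡0)) (Δ ∣ₚ.∣0)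
    ... | no  c≢0 = subst (Δ ∣_) (sym (weight-codeword c c∈C c≢0)) Δ∣W

    minimal : IsMinimalCode code
    minimal c c∈C c≢0 = c≢0 , λ (u , u∈C , u≢0 , u⊊c) →
      ℕₚ.<⇒≢ (weight-mono-⊊supp u≢0 u⊊c) (trans (weight-codeword u u∈C u≢0) (sym (weight-codeword c c∈C c≢0)))

  module ReplicatedSimplex (k t : ℕ) where

    columns : List (Vector Carrier k)
    columns = concat (replicate t (points k))

    generator : Fin k → Word (length columns)
    generator j i = lookup columns i j

    weight-comb : ∀ a → NonzeroVector a → weight (comb a generator) ≡ t * q ^ (k ∸ 1)
    weight-comb a a≢0 = begin
      weight (comb a generator)                          ≡⟨ weight≡sum (comb a generator) ⟩
      sum (λ i → 𝟙[≢0] (dot a (lookup columns i)))       ≡⟨ sum-lookup (𝟙[≢0] ∘ dot a) columns ⟩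
      sumₗ (𝟙[≢0] ∘ dot a) columns                       ≡⟨ sumₗ-concat-replicate _ t (points k) ⟩
      t * sumₗ (𝟙[≢0] ∘ dot a) (points k)                ≡⟨ cong (t *_) (points-nonorthogonal k a a≢0) ⟩
      t * q ^ (k ∸ 1)                                    ∎

    length-columns : length columns ≡ t * [ k ]q
    length-columns = begin
      length columns                   ≡⟨ length≡sumₗ-1 columns ⟩
      sumₗ (λ _ → 1) columns           ≡⟨ sumₗ-concat-replicate _ t (points k) ⟩
      t * sumₗ (λ _ → 1) (points k)    ≡⟨ cong (t *_) (#points k) ⟩
      t * [ k ]q                       ∎


mainTheorem1 : (q : ℕ) → IsPrimePower q → (F : FiniteField q) →
    (k r : ℕ) → 1 ≤ k → k ∸ 1 ≤ r →
    Σ ℕ λ m → Codes.IsMinLength F k (q ^ r) m ×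
      (m * (q ∸ 1) ≡ q ^ (r ∸ (k ∸ 1)) * (q ^ k ∸ 1))
mainTheorem1 q _ F k r _ k-1≤r = length columns , (admissible , minimum) , length-formula
  where
  open CodesOver F
  t = q ^ (r ∸ (k ∸ 1))
  open ReplicatedSimplex k t
  open ConstantWeight generator (q ^ r) {{ℕₚ.m^n≢0 q r}}
    (λ a a≢0 → trans (weight-comb a a≢0) (^-∸-* q k-1≤r))
  admissible : Codes.Admissible F k (q ^ r) (length columns)
  admissible = code , divisible ∣ₚ.∣-refl , minimal
  minimum : ∀ n → Codes.Admissible F k (q ^ r) n → length columns ≤ n
  minimum n (C , C-divisible , _) = subst (_≤ n) (sym length-columns) (length-lowerBound k-1≤r C C-divisible)
  length-formula : length columns * (q ∸ 1) ≡ t * (q ^ k ∸ 1)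
  length-formula = begin
    length columns * (q ∸ 1)  ≡⟨ cong (_* (q ∸ 1)) length-columns ⟩
    t * [ k ]q * (q ∸ 1)      ≡⟨ ℕₚ.*-assoc t [ k ]q (q ∸ 1) ⟩
    t * ([ k ]q * (q ∸ 1))    ≡⟨ cong (t *_) [ k ]q*[q-1] ⟩
    t * (q ^ k ∸ 1)           ∎
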